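{- Let $a,b$ be integers and let $f:\mathbb{Z}\to\mathbb{Z}$ be supported on the interval $I=[-a,b]$ and satisfy \[ \sum_{y\in I} f(y)=\sum_{y\in I} y f(y)=0. \] Then $f=\Delta g$ for an integer-valued function $g$ supported on the interval $I'=[1-a,b-1]$, where $\Delta g(x)=g(x+1)-2g(x)+g(x-1)$. Moreover, if there are no $x_1<x_2<x_3$ such that $f(x_1)<0$, $f(x_2)>0$ and $f(x_3)<0$, then $g\ge0$. -}

module Defs where

open import Data.Nat using (ℕ; zero; suc)
open import Data.Integer using (ℤ; _+_; _-_; _*_; -_; _<_; _≤_; +_; -[1+_]; 0ℤ; 1ℤ)
open import Data.Product using (_×_; ∃; Σ)
open import Relation.Binary.PropositionalEquality using (_≡_)
open import Relation.Nullary using (¬_)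

sumFrom : ℤ → ℕ → (ℤ → ℤ) → ℤ
sumFrom lo zero    h = 0ℤ
sumFrom lo (suc n) h = h lo + sumFrom (lo + 1ℤ) n h

clamp : ℤ → ℕ
clamp (+ n)      = n
clamp -[1+ n ]   = 0

-- Σ_{y = lo}^{hi} h y  (empty sum = 0 when hi < lo)
sumInterval : ℤ → ℤ → (ℤ → ℤ) → ℤ
sumInterval lo hi h = sumFrom lo (clamp (hi - lo + 1ℤ)) h

SupportedOn : ℤ → ℤ → (ℤ → ℤ) → Set
SupportedOn lo hi f = ∀ x → (x < lo → f x ≡ 0ℤ) × (hi < x → f x ≡ 0ℤ)

Δ : (ℤ → ℤ) → ℤ → ℤ
Δ g x = g (x + 1ℤ) - + 2 * g x + g (x - 1ℤ)

SignPattern−+− : (ℤ → ℤ) → Set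
SignPattern−+− f =
  Σ ℤ λ x₁ → Σ ℤ λ x₂ → Σ ℤ λ x₃ →
    x₁ < x₂ × x₂ < x₃ × f x₁ < 0ℤ × 0ℤ < f x₂ × f x₃ < 0ℤ

-- Since Δ (x ↦ (x - y)⁺) is the indicator of y, the potential g(x) = Σ_y (x - y)⁺ f(y)
-- satisfies Δg = f, and it vanishes to the left of the support of f. The two moment
-- conditions say Σ_y (x - y) f(y) = 0, so also g(x) = Σ_y (y - x)⁺ f(y), which vanishes to
-- the right of the support. If g is negative somewhere, finite support gives a point q with
-- g(q) < 0 < Δg(q) = f(q); each of the two formulas for g(q) then has a negative term,
-- which yields y < q < z with f(y) < 0 and f(z) < 0.
module Submission where

open import Defs
open import Data.Nat using (ℕ; zero; suc; s≤s; z≤n)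
open import Data.Integer
  using (ℤ; _+_; _-_; _*_; -_; _<_; _≤_; 0ℤ; 1ℤ; -1ℤ; +_; -[1+_]; +<+; +≤+; -≤+; _≤?_; _<?_; _≟_)
  renaming (suc to sucℤ)
open import Data.Integer.Properties
  using (≤-refl; ≤-trans; <-≤-trans; ≤-<-trans; <-trans; <-irrefl; ≤⇒≯; ≰⇒>; ≮⇒≥; ≤∧≢⇒<;
         +-identityˡ; +-identityʳ; +-assoc; +-comm; +-inverseʳ; +-monoʳ-≤; +-mono-≤;
         +-monoˡ-<; +-mono-≤-<; *-identityˡ; *-zeroʳ; *-monoˡ-≤-nonNeg; i-j≡0⇒i≡j;
         i≤j⇒0≤j-i; i<j⇒suc[i]≤j; suc[i]≤j⇒i<j; i<j⇒i≤pred[j]; pred-suc)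
open import Data.Integer.Tactic.RingSolver using (solve-∀)
open import Data.Product using (_×_; Σ; _,_; proj₁; proj₂)
open import Function using (_∘_)
open import Relation.Binary.PropositionalEquality
  using (_≡_; _≢_; refl; sym; trans; cong; cong₂; subst; subst₂; module ≡-Reasoning)
open import Relation.Nullary using (¬_; yes; no; contradiction)

open ≡-Reasoning

i<j⇒0<j-i : ∀ {i j} → i < j → 0ℤ < j - i
i<j⇒0<j-i {i} {j} p = subst (_< j - i) (+-inverseʳ i) (+-monoˡ-< (- i) p)

0<j-i⇒i<j : ∀ {i j} → 0ℤ < j - i → i < j
0<j-i⇒i<j {i} {j} p = subst₂ _<_ (+-identityˡ i) (j-i+i≡j i j) (+-monoˡ-< i p)
  where
  j-i+i≡j : ∀ i j → j - i + i ≡ j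
  j-i+i≡j = solve-∀

i<1+j⇒i≤j : ∀ {i j} → i < sucℤ j → i ≤ j
i<1+j⇒i≤j {j = j} p = subst (_ ≤_) (pred-suc j) (i<j⇒i≤pred[j] p)

i-1<j⇒i≤j : ∀ {i j} → i - 1ℤ < j → i ≤ j
i-1<j⇒i≤j {i} {j} p = subst (_≤ j) (1+[i-1]≡i i) (i<j⇒suc[i]≤j p)
  where
  1+[i-1]≡i : ∀ i → 1ℤ + (i - 1ℤ) ≡ i
  1+[i-1]≡i = solve-∀

ramp : ℤ → ℤ
ramp t = + clamp t

i≤ramp[i] : ∀ i → i ≤ ramp i
i≤ramp[i] (+ n)    = ≤-refl
i≤ramp[i] -[1+ n ] = -≤+

ramp-nonpos : ∀ {t} → t ≤ 0ℤ → ramp t ≡ 0ℤ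
ramp-nonpos {+ zero}   _ = refl
ramp-nonpos { -[1+ n ]} _ = refl
ramp-nonpos {+ suc n}  (+≤+ ())

ramp-odd : ∀ t → ramp t - ramp (- t) ≡ t
ramp-odd (+ zero)   = refl
ramp-odd (+ suc n)  = +-identityʳ (+ suc n)
ramp-odd -[1+ n ]   = refl

Δramp-≢0 : ∀ {t} → t ≢ 0ℤ → Δ ramp t ≡ 0ℤ
Δramp-≢0 {+ zero}       t≢0 = contradiction refl t≢0
Δramp-≢0 {+ suc n}      _   = linear (+ suc n)
  where
  linear : ∀ t → (t + 1ℤ) - + 2 * t + (t - 1ℤ) ≡ 0ℤ
  linear = solve-∀
Δramp-≢0 { -[1+ zero ]}  _  = refl
Δramp-≢0 { -[1+ suc n ]} _  = refl

ramp*c≡0 : ∀ t c → (0ℤ < t → c ≡ 0ℤ) → ramp t * c ≡ 0ℤ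
ramp*c≡0 t c t>0⇒c≡0 with 0ℤ <? t
... | yes t>0 = trans (cong (ramp t *_) (t>0⇒c≡0 t>0)) (*-zeroʳ (ramp t))
... | no  t≯0 = cong (_* c) (ramp-nonpos (≮⇒≥ t≯0))

ramp*c<0⇒ : ∀ t c → ramp t * c < 0ℤ → 0ℤ < t × c < 0ℤ
ramp*c<0⇒ (+ zero)   c p = contradiction p (<-irrefl refl)
ramp*c<0⇒ -[1+ n ]   c p = contradiction p (<-irrefl refl)
ramp*c<0⇒ (+ suc n)  c p with c <? 0ℤ
... | yes c<0 = +<+ (s≤s z≤n) , c<0
... | no  c≮0 = contradiction p (≤⇒≯ (subst (_≤ + suc n * c) (*-zeroʳ (+ suc n))
                                          (*-monoˡ-≤-nonNeg (+ suc n) (≮⇒≥ c≮0))))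

ramp-antisymmetrisation : ∀ x y c → ramp (x - y) * c - ramp (y - x) * c ≡ x * c - y * c
ramp-antisymmetrisation x y c = begin
  ramp (x - y) * c - ramp (y - x) * c      ≡⟨ cong (λ t → ramp (x - y) * c - ramp t * c) (y-x≡-[x-y] x y) ⟩
  ramp (x - y) * c - ramp (- (x - y)) * c  ≡⟨ factor (ramp (x - y)) (ramp (- (x - y))) c ⟩
  (ramp (x - y) - ramp (- (x - y))) * c    ≡⟨ cong (_* c) (ramp-odd (x - y)) ⟩
  (x - y) * c                              ≡⟨ factor x y c ⟨
  x * c - y * c                            ∎
  where
  y-x≡-[x-y] : ∀ x y → y - x ≡ - (x - y)
  y-x≡-[x-y] = solve-∀
  factor : ∀ u v c → u * c - v * c ≡ (u - v) * c
  factor = solve-∀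

InRange : ℤ → ℕ → ℤ → Set
InRange lo n y = lo ≤ y × y < lo + + n

InRange-zero : ∀ {lo y} → ¬ InRange lo zero y
InRange-zero {lo} (lo≤y , y<lo+0) =
  <-irrefl refl (<-≤-trans (subst (_ <_) (+-identityʳ lo) y<lo+0) lo≤y)

InRange-start : ∀ {lo n} → InRange lo (suc n) lo
InRange-start {lo} {n} =
  ≤-refl , suc[i]≤j⇒i<j (subst (_≤ lo + + suc n) (+-comm lo 1ℤ) (+-monoʳ-≤ lo (+≤+ (s≤s z≤n))))

InRange-suc⁺ : ∀ {lo n y} → InRange (lo + 1ℤ) n y → InRange lo (suc n) y
InRange-suc⁺ {lo} {n} (lo+1≤y , y<lo+1+n) =
  ≤-trans (i≤i+1 lo) lo+1≤y , subst (_ <_) (+-assoc lo 1ℤ (+ n)) y<lo+1+n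
  where
  i≤i+1 : ∀ i → i ≤ i + 1ℤ
  i≤i+1 i = subst (_≤ i + 1ℤ) (+-identityʳ i) (+-monoʳ-≤ i (+≤+ z≤n))

InRange-suc⁻ : ∀ {lo n y} → InRange lo (suc n) y → lo ≢ y → InRange (lo + 1ℤ) n y
InRange-suc⁻ {lo} {n} (lo≤y , y<lo+1+n) lo≢y =
  subst (_≤ _) (+-comm 1ℤ lo) (i<j⇒suc[i]≤j (≤∧≢⇒< lo≤y lo≢y)) ,
  subst (_ <_) (sym (+-assoc lo 1ℤ (+ n))) y<lo+1+n

sumFrom-cong : ∀ lo n {h₁ h₂ : ℤ → ℤ} → (∀ y → InRange lo n y → h₁ y ≡ h₂ y) →
               sumFrom lo n h₁ ≡ sumFrom lo n h₂
sumFrom-cong lo zero    eq = refl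
sumFrom-cong lo (suc n) eq =
  cong₂ _+_ (eq lo InRange-start) (sumFrom-cong (lo + 1ℤ) n (λ y → eq y ∘ InRange-suc⁺))

sumFrom-vanishing : ∀ lo n {h : ℤ → ℤ} → (∀ y → InRange lo n y → h y ≡ 0ℤ) →
                    sumFrom lo n h ≡ 0ℤ
sumFrom-vanishing lo zero    eq = refl
sumFrom-vanishing lo (suc n) eq =
  cong₂ _+_ (eq lo InRange-start) (sumFrom-vanishing (lo + 1ℤ) n (λ y → eq y ∘ InRange-suc⁺))

sumFrom-single : ∀ lo n {h : ℤ → ℤ} {x} → InRange lo n x → (∀ y → y ≢ x → h y ≡ 0ℤ) →
                 sumFrom lo n h ≡ h x
sumFrom-single lo zero    x∈ _ = contradiction x∈ InRange-zero
sumFrom-single lo (suc n) {h} {x} x∈ others with lo ≟ x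
... | yes refl = trans (cong (_+_ (h x)) (sumFrom-vanishing (x + 1ℤ) n rest)) (+-identityʳ (h x))
  where
  rest : ∀ y → InRange (x + 1ℤ) n y → h y ≡ 0ℤ
  rest y (x+1≤y , _) =
    others y λ { refl → <-irrefl refl (suc[i]≤j⇒i<j (subst (_≤ y) (+-comm y 1ℤ) x+1≤y)) }
... | no lo≢x  =
  trans (cong₂ _+_ (others lo lo≢x) (sumFrom-single (lo + 1ℤ) n (InRange-suc⁻ x∈ lo≢x) others))
        (+-identityˡ (h x))

sumFrom-− : ∀ lo n (h₁ h₂ : ℤ → ℤ) →
            sumFrom lo n h₁ - sumFrom lo n h₂ ≡ sumFrom lo n (λ y → h₁ y - h₂ y)
sumFrom-− lo zero    h₁ h₂ = refl
sumFrom-− lo (suc n) h₁ h₂ =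
  trans (interchange (h₁ lo) (h₂ lo) (sumFrom (lo + 1ℤ) n h₁) (sumFrom (lo + 1ℤ) n h₂))
        (cong (_+_ (h₁ lo - h₂ lo)) (sumFrom-− (lo + 1ℤ) n h₁ h₂))
  where
  interchange : ∀ a b s t → (a + s) - (b + t) ≡ (a - b) + (s - t)
  interchange = solve-∀

sumFrom-*ˡ : ∀ lo n c (h : ℤ → ℤ) → c * sumFrom lo n h ≡ sumFrom lo n (λ y → c * h y)
sumFrom-*ˡ lo zero    c h = *-zeroʳ c
sumFrom-*ˡ lo (suc n) c h =
  trans (distrib c (h lo) (sumFrom (lo + 1ℤ) n h))
        (cong (_+_ (c * h lo)) (sumFrom-*ˡ (lo + 1ℤ) n c h))
  where
  distrib : ∀ c a s → c * (a + s) ≡ c * a + c * s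
  distrib = solve-∀

sumFrom<0⇒term<0 : ∀ lo n (h : ℤ → ℤ) → sumFrom lo n h < 0ℤ → Σ ℤ λ y → h y < 0ℤ
sumFrom<0⇒term<0 lo zero    h s<0 = contradiction s<0 (<-irrefl refl)
sumFrom<0⇒term<0 lo (suc n) h s<0 with h lo <? 0ℤ
... | yes hlo<0 = lo , hlo<0
... | no  hlo≮0 with sumFrom (lo + 1ℤ) n h <? 0ℤ
...   | yes rest<0 = sumFrom<0⇒term<0 (lo + 1ℤ) n h rest<0
...   | no  rest≮0 = contradiction s<0 (≤⇒≯ (+-mono-≤ (≮⇒≥ hlo≮0) (≮⇒≥ rest≮0)))

Δ-+ : ∀ (u v : ℤ → ℤ) x → Δ (λ x → u x + v x) x ≡ Δ u x + Δ v x
Δ-+ u v x = regroup (u (x + 1ℤ)) (u x) (u (x - 1ℤ)) (v (x + 1ℤ)) (v x) (v (x - 1ℤ))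
  where
  regroup : ∀ a b c p q r →
    (a + p) - + 2 * (b + q) + (c + r) ≡ (a - + 2 * b + c) + (p - + 2 * q + r)
  regroup = solve-∀

Δ-translate-scale : ∀ (k : ℤ → ℤ) y c x → Δ (λ x → k (x - y) * c) x ≡ Δ k (x - y) * c
Δ-translate-scale k y c x = begin
  k (x + 1ℤ - y) * c - + 2 * (k (x - y) * c) + k (x - 1ℤ - y) * c
    ≡⟨ cong₂ (λ s t → k s * c - + 2 * (k (x - y) * c) + k t * c) (shift x 1ℤ y) (shift x -1ℤ y) ⟩
  k (x - y + 1ℤ) * c - + 2 * (k (x - y) * c) + k (x - y - 1ℤ) * c
    ≡⟨ factor (k (x - y + 1ℤ)) (k (x - y)) (k (x - y - 1ℤ)) c ⟩
  Δ k (x - y) * c ∎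
  where
  shift : ∀ x d y → x + d - y ≡ x - y + d
  shift = solve-∀
  factor : ∀ a b d c → a * c - + 2 * (b * c) + d * c ≡ (a - + 2 * b + d) * c
  factor = solve-∀

Δ-sumFrom-convolution : ∀ (k h : ℤ → ℤ) lo n x →
  Δ (λ x → sumFrom lo n (λ y → k (x - y) * h y)) x ≡ sumFrom lo n (λ y → Δ k (x - y) * h y)
Δ-sumFrom-convolution k h lo zero    x = refl
Δ-sumFrom-convolution k h lo (suc n) x = begin
  Δ (λ x → k (x - lo) * h lo + S x) x   ≡⟨ Δ-+ (λ x → k (x - lo) * h lo) S x ⟩
  Δ (λ x → k (x - lo) * h lo) x + Δ S x ≡⟨ cong₂ _+_ (Δ-translate-scale k lo (h lo) x)
                                                    (Δ-sumFrom-convolution k h (lo + 1ℤ) n x) ⟩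
  Δ k (x - lo) * h lo + sumFrom (lo + 1ℤ) n (λ y → Δ k (x - y) * h y) ∎
  where
  S : ℤ → ℤ
  S x = sumFrom (lo + 1ℤ) n (λ y → k (x - y) * h y)

potential : ℤ → ℕ → (ℤ → ℤ) → ℤ → ℤ
potential lo n f x = sumFrom lo n (λ y → ramp (x - y) * f y)

Δramp[x-y]*c≡0 : ∀ x y c → y ≢ x → Δ ramp (x - y) * c ≡ 0ℤ
Δramp[x-y]*c≡0 x y c y≢x = cong (_* c) (Δramp-≢0 (λ x-y≡0 → y≢x (sym (i-j≡0⇒i≡j x y x-y≡0))))

Δ-potential : ∀ lo n f → (∀ x → ¬ InRange lo n x → f x ≡ 0ℤ) → ∀ x → Δ (potential lo n f) x ≡ f x
Δ-potential lo n f outside x = trans (Δ-sumFrom-convolution ramp f lo n x) δ-sum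
  where
  Δramp[0]*c≡c : ∀ c → Δ ramp (x - x) * c ≡ c
  Δramp[0]*c≡c c = trans (cong (λ t → Δ ramp t * c) (+-inverseʳ x)) (*-identityˡ c)

  δ-sum-outside : ¬ InRange lo n x → sumFrom lo n (λ y → Δ ramp (x - y) * f y) ≡ f x
  δ-sum-outside x∉ = trans (sumFrom-vanishing lo n λ y y∈ → Δramp[x-y]*c≡0 x y (f y) λ { refl → x∉ y∈ })
                           (sym (outside x x∉))

  δ-sum : sumFrom lo n (λ y → Δ ramp (x - y) * f y) ≡ f x
  δ-sum with lo ≤? x | x <? lo + + n
  ... | yes lo≤x | yes x<lo+n =
    trans (sumFrom-single lo n (lo≤x , x<lo+n) (λ y → Δramp[x-y]*c≡0 x y (f y))) (Δramp[0]*c≡c (f x))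
  ... | no  lo≰x | _          = δ-sum-outside (lo≰x ∘ proj₁)
  ... | _        | no x≮lo+n  = δ-sum-outside (x≮lo+n ∘ proj₂)

potential-vanishes-left : ∀ lo n f {x} → (∀ y → y < x → f y ≡ 0ℤ) → potential lo n f x ≡ 0ℤ
potential-vanishes-left lo n f {x} vanish =
  sumFrom-vanishing lo n λ y _ → ramp*c≡0 (x - y) (f y) (vanish y ∘ 0<j-i⇒i<j)

potential-reflection : ∀ lo n f → sumFrom lo n f ≡ 0ℤ → sumFrom lo n (λ y → y * f y) ≡ 0ℤ →
                       ∀ x → potential lo n f x ≡ sumFrom lo n (λ y → ramp (y - x) * f y)
potential-reflection lo n f Σf≡0 Σyf≡0 x = i-j≡0⇒i≡j _ _ (begin
  potential lo n f x - sumFrom lo n (λ y → ramp (y - x) * f y)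
    ≡⟨ sumFrom-− lo n _ _ ⟩
  sumFrom lo n (λ y → ramp (x - y) * f y - ramp (y - x) * f y)
    ≡⟨ sumFrom-cong lo n (λ y _ → ramp-antisymmetrisation x y (f y)) ⟩
  sumFrom lo n (λ y → x * f y - y * f y)
    ≡⟨ sumFrom-− lo n _ _ ⟨
  sumFrom lo n (λ y → x * f y) - sumFrom lo n (λ y → y * f y)
    ≡⟨ cong₂ _-_ (sumFrom-*ˡ lo n x f) (sym Σyf≡0) ⟨
  x * sumFrom lo n f - 0ℤ
    ≡⟨ cong (λ s → x * s - 0ℤ) Σf≡0 ⟩
  x * 0ℤ - 0ℤ
    ≡⟨ cong (_- 0ℤ) (*-zeroʳ x) ⟩
  0ℤ ∎)

potential-vanishes-right : ∀ lo n f → sumFrom lo n f ≡ 0ℤ → sumFrom lo n (λ y → y * f y) ≡ 0ℤ →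
                           ∀ {x} → (∀ y → x < y → f y ≡ 0ℤ) → potential lo n f x ≡ 0ℤ
potential-vanishes-right lo n f Σf≡0 Σyf≡0 {x} vanish =
  trans (potential-reflection lo n f Σf≡0 Σyf≡0 x)
        (sumFrom-vanishing lo n λ y _ → ramp*c≡0 (y - x) (f y) (vanish y ∘ 0<j-i⇒i<j))

ramp[j-i]*c<0⇒ : ∀ i j c → ramp (j - i) * c < 0ℤ → i < j × c < 0ℤ
ramp[j-i]*c<0⇒ i j c p = let (j-i>0 , c<0) = ramp*c<0⇒ (j - i) c p in 0<j-i⇒i<j j-i>0 , c<0

negative-potential⇒sign-pattern :
  ∀ lo n f → sumFrom lo n f ≡ 0ℤ → sumFrom lo n (λ y → y * f y) ≡ 0ℤ →
  ∀ q → potential lo n f q < 0ℤ → 0ℤ < f q → SignPattern−+− f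
negative-potential⇒sign-pattern lo n f Σf≡0 Σyf≡0 q gq<0 fq>0 =
  let gq<0′         = subst (_< 0ℤ) (potential-reflection lo n f Σf≡0 Σyf≡0 q) gq<0
      (y , left<0)  = sumFrom<0⇒term<0 lo n _ gq<0
      (z , right<0) = sumFrom<0⇒term<0 lo n _ gq<0′
      (y<q , fy<0)  = ramp[j-i]*c<0⇒ y q (f y) left<0
      (q<z , fz<0)  = ramp[j-i]*c<0⇒ q z (f z) right<0
  in y , q , z , y<q , q<z , fy<0 , fq>0 , fz<0

b<lo+length : ∀ lo b → b < lo + + clamp (b - lo + 1ℤ)
b<lo+length lo b =
  suc[i]≤j⇒i<j (subst (_≤ lo + ramp d) (lo+d≡1+b lo b) (+-monoʳ-≤ lo (i≤ramp[i] d)))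
  where
  d : ℤ
  d = b - lo + 1ℤ
  lo+d≡1+b : ∀ lo b → lo + (b - lo + 1ℤ) ≡ 1ℤ + b
  lo+d≡1+b = solve-∀

Δ>0-at-strict-local-min : ∀ (g : ℤ → ℤ) {p} → g p ≤ g (p + 1ℤ) → g p < g (p - 1ℤ) → 0ℤ < Δ g p
Δ>0-at-strict-local-min g {p} rise drop =
  subst (0ℤ <_) (regroup (g (p + 1ℤ)) (g p) (g (p - 1ℤ)))
        (+-mono-≤-< (i≤j⇒0≤j-i rise) (i<j⇒0<j-i drop))
  where
  regroup : ∀ u v w → (u - v) + (w - v) ≡ u - + 2 * v + w
  regroup = solve-∀

-- Walking right from a negative value, g must stop decreasing before it reaches 0 beyond R.
negative⇒negative-rise : ∀ {R} (g : ℤ → ℤ) → (∀ t → R < t → g t ≡ 0ℤ) →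
  ∀ k p → R < p + + k → g p < 0ℤ → Σ ℤ λ q → g q < 0ℤ × g q ≤ g (q + 1ℤ)
negative⇒negative-rise {R} g vanish zero    p R<p+0 gp<0 =
  contradiction gp<0 (<-irrefl (vanish p (subst (R <_) (+-identityʳ p) R<p+0)))
negative⇒negative-rise {R} g vanish (suc k) p R<p+1+k gp<0 with g p ≤? g (p + 1ℤ)
... | yes rise = p , gp<0 , rise
... | no  fall = negative⇒negative-rise g vanish k (p + 1ℤ)
                   (subst (R <_) (sym (+-assoc p 1ℤ (+ k))) R<p+1+k) (<-trans (≰⇒> fall) gp<0)

-- Walking left from a negative rise, g must strictly drop into it before it reaches 0 below L.
negative-rise⇒convex : ∀ {L} (g : ℤ → ℤ) → (∀ t → t < L → g t ≡ 0ℤ) →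
  ∀ k p → p < L + + k → g p < 0ℤ → g p ≤ g (p + 1ℤ) → Σ ℤ λ q → g q < 0ℤ × 0ℤ < Δ g q
negative-rise⇒convex {L} g vanish zero    p p<L+0 gp<0 _ =
  contradiction gp<0 (<-irrefl (vanish p (subst (p <_) (+-identityʳ L) p<L+0)))
negative-rise⇒convex {L} g vanish (suc k) p p<L+1+k gp<0 rise with g p <? g (p - 1ℤ)
... | yes drop = p , gp<0 , Δ>0-at-strict-local-min g rise drop
... | no  g[p-1]≮gp =
  negative-rise⇒convex g vanish k (p - 1ℤ) p-1<L+k (≤-<-trans g[p-1]≤gp gp<0)
                       (subst (λ t → g (p - 1ℤ) ≤ g t) (sym (p-1+1≡p p)) g[p-1]≤gp)
  where
  g[p-1]≤gp : g (p - 1ℤ) ≤ g p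
  g[p-1]≤gp = ≮⇒≥ g[p-1]≮gp
  p-1+1≡p : ∀ p → p - 1ℤ + 1ℤ ≡ p
  p-1+1≡p = solve-∀
  L+[1+k]≡1+[L+k] : ∀ L k → L + (1ℤ + k) ≡ 1ℤ + (L + k)
  L+[1+k]≡1+[L+k] = solve-∀
  p-1<L+k : p - 1ℤ < L + + k
  p-1<L+k = suc[i]≤j⇒i<j (subst (_≤ L + + k) (sym (1+[p-1]≡p p))
                            (i<1+j⇒i≤j (subst (p <_) (L+[1+k]≡1+[L+k] L (+ k)) p<L+1+k)))
    where
    1+[p-1]≡p : ∀ p → 1ℤ + (p - 1ℤ) ≡ p
    1+[p-1]≡p = solve-∀

negative⇒convex-negative : ∀ {L R} (g : ℤ → ℤ) → SupportedOn L R g → ∀ x → g x < 0ℤ →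
  Σ ℤ λ q → g q < 0ℤ × 0ℤ < Δ g q
negative⇒convex-negative {L} {R} g supp x gx<0 =
  let (p , gp<0 , rise) = negative⇒negative-rise g (proj₂ ∘ supp) _ x (b<lo+length x R) gx<0
  in negative-rise⇒convex g (proj₁ ∘ supp) _ p (b<lo+length L p) gp<0 rise

lemma3p3 : (a b : ℤ) (f : ℤ → ℤ) →
    SupportedOn (- a) b f →
    sumInterval (- a) b f ≡ 0ℤ →
    sumInterval (- a) b (λ y → y * f y) ≡ 0ℤ →
    Σ (ℤ → ℤ) λ g →
      SupportedOn (1ℤ - a) (b - 1ℤ) g ×
      (∀ x → f x ≡ Δ g x) ×
      (¬ SignPattern−+− f → ∀ x → 0ℤ ≤ g x)
lemma3p3 a b f f-supp Σf≡0 Σyf≡0 = g , g-supp , (λ x → sym (Δg≡f x)) , g≥0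
  where
  n : ℕ
  n = clamp (b - - a + 1ℤ)
  g : ℤ → ℤ
  g = potential (- a) n f

  f-outside : ∀ x → ¬ InRange (- a) n x → f x ≡ 0ℤ
  f-outside x x∉ with x <? - a
  ... | yes x<-a = proj₁ (f-supp x) x<-a
  ... | no  x≮-a =
    proj₂ (f-supp x) (<-≤-trans (b<lo+length (- a) b) (≮⇒≥ (x∉ ∘ (≮⇒≥ x≮-a ,_))))

  g-supp : SupportedOn (1ℤ - a) (b - 1ℤ) g
  g-supp x =
    (λ x<1-a → potential-vanishes-left (- a) n f λ y y<x →
                 proj₁ (f-supp y) (<-≤-trans y<x (i<1+j⇒i≤j x<1-a))) ,
    (λ b-1<x → potential-vanishes-right (- a) n f Σf≡0 Σyf≡0 λ y x<y →
                 proj₂ (f-supp y) (≤-<-trans (i-1<j⇒i≤j b-1<x) x<y))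

  Δg≡f : ∀ x → Δ g x ≡ f x
  Δg≡f = Δ-potential (- a) n f f-outside

  g≥0 : ¬ SignPattern−+− f → ∀ x → 0ℤ ≤ g x
  g≥0 no-pattern x = ≮⇒≥ λ gx<0 →
    let (q , gq<0 , Δgq>0) = negative⇒convex-negative g g-supp x gx<0
    in no-pattern (negative-potential⇒sign-pattern (- a) n f Σf≡0 Σyf≡0 q gq<0
                                                   (subst (0ℤ <_) (Δg≡f q) Δgq>0))
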